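{- Let $T=H(b,\delta,\lambda)$ be a balanced HST with $0<\lambda<1$ and $b\lambda\ge1$. Assume that $k$ points are assigned to vertices of $T$, with $k$ even. Then the minimum matching for this point set has total cost at most $2\cdot Top(k)/(1-\lambda)$.
   Context: A balanced HST $H(b,\delta,\lambda)$ (integers $b\ge2$, $\delta\ge1$) is a rooted tree in which every non-leaf vertex has exactly $b$ children and every leaf is at depth $\delta$; the root is at level $0$, and each edge joining a vertex at level $\ell-1$ to a child at level $\ell$ has weight $\lambda^\ell$. Distances between points are tree-path weights (points at the same vertex are at distance $0$). The minimum matching cost of an even-size point multiset is the minimum, over perfect matchings of its complete graph, of the sum of distances of matched pairs. $Top(k)$ is the sum of the edge lengths of the first $\lceil\log_b k\rceil$ levels of $T$, i.e. $Top(k)=\sum_{\ell=1}^{\min(\delta,\lceil\log_b k\rceil)}b^\ell\lambda^\ell$.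
   Formalization: The parameter λ of the balanced HST ranges over the rationals, so the edge weights λ^ℓ are rational. -}

module Defs where

open import Data.Nat as ℕ using (ℕ; zero; suc)
open import Data.Fin using (Fin; _≟_)
open import Data.List using (List; []; _∷_; length; concatMap; map; sum)
open import Data.Product using (Σ; _×_; _,_; proj₁)
open import Data.Rational as ℚ using (ℚ; 0ℚ; 1ℚ; _+_; _*_)
open import Data.Integer using (+_)
open import Relation.Nullary using (yes; no)
open import Data.Nat.Properties using () renaming (_≤?_ to _≤ℕ?_)
open import Relation.Binary.PropositionalEquality using (_≡_)
open import Data.List.Relation.Binary.Permutation.Propositional using (_↭_)

_^ℚ_ : ℚ → ℕ → ℚ
q ^ℚ zero  = 1ℚ
q ^ℚ suc n = q * (q ^ℚ n)

ℕ→ℚ : ℕ → ℚ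
ℕ→ℚ n = + n ℚ./ 1

-- Vertices of H(b, δ, λ): the path of child indices from the root;
-- a vertex at level ℓ is a list of length ℓ ≤ δ (the root is []).
Vertex : ℕ → ℕ → Set
Vertex b δ = Σ (List (Fin b)) (λ p → length p ℕ.≤ δ)

-- weight of the downward path from a vertex at level d following xs:
-- the edge into level (d+1) has weight λ^(d+1), etc.
climb : ∀ {b} → ℚ → ℕ → List (Fin b) → ℚ
climb λ' d []       = 0ℚ
climb λ' d (_ ∷ xs) = (λ' ^ℚ suc d) + climb λ' (suc d) xs

-- tree distance between the vertices with paths xs, ys below a common
-- ancestor at level d (walk down the common prefix, then sum both branches)
distFrom : ∀ {b} → ℚ → ℕ → List (Fin b) → List (Fin b) → ℚ
distFrom λ' d []       ys       = climb λ' d ys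
distFrom λ' d (x ∷ xs) []       = climb λ' d (x ∷ xs)
distFrom λ' d (x ∷ xs) (y ∷ ys) with x ≟ y
... | yes _ = distFrom λ' (suc d) xs ys
... | no  _ = climb λ' d (x ∷ xs) + climb λ' d (y ∷ ys)

dist : ∀ {b δ} → ℚ → Vertex b δ → Vertex b δ → ℚ
dist λ' (xs , _) (ys , _) = distFrom λ' 0 xs ys

-- a perfect matching of a point multiset `pts` is a list of pairs whose
-- concatenation is a permutation of pts (each point used exactly once)
flatten : {A : Set} → List (A × A) → List A
flatten = concatMap (λ { (u , v) → u ∷ v ∷ [] })

IsPerfectMatching : {A : Set} → List (A × A) → List A → Set
IsPerfectMatching ms pts = flatten ms ↭ pts

matchingCost : ∀ {b δ} → ℚ → List (Vertex b δ × Vertex b δ) → ℚ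
matchingCost λ' ms = sum' (map (λ { (u , v) → dist λ' u v }) ms)
  where
  sum' : List ℚ → ℚ
  sum' []       = 0ℚ
  sum' (q ∷ qs) = q + sum' qs

-- ⌈log_b k⌉ : the least m with k ≤ b^m (search m = 0,1,..., fuel k suffices for b ≥ 2)
ceilLogFrom : ℕ → ℕ → ℕ → ℕ → ℕ
ceilLogFrom b k m zero = m
ceilLogFrom b k m (suc fuel) with k ≤ℕ? b ℕ.^ m
... | yes _ = m
... | no  _ = ceilLogFrom b k (suc m) fuel

ceilLog : ℕ → ℕ → ℕ
ceilLog b k = ceilLogFrom b k 0 k

levelSum : ℕ → ℚ → ℕ → ℚ
levelSum b λ' zero    = 0ℚ
levelSum b λ' (suc n) = levelSum b λ' n + (ℕ→ℚ (b ℕ.^ suc n) * (λ' ^ℚ suc n))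

Top : ℕ → ℕ → ℚ → ℕ → ℚ
Top b δ λ' k = levelSum b λ' (ℕ._⊓_ δ (ceilLog b k))

-- The matching is built greedily from the leaves up: at every vertex, first match recursively
-- inside each child subtree, which leaves at most one point per child unmatched, then pair up
-- these leftovers together with the points sitting at the vertex, leaving at most one. A pair
-- formed at a vertex costs at most the climbs of its two points up to that vertex, so the total
-- cost is at most Σ_ℓ c_ℓ λ^ℓ, where c_ℓ ≤ min (b^ℓ, k) counts the points climbing an edge of
-- level ℓ. After multiplying by 1 - λ, the levels ℓ ≤ L = min (δ, ⌈log_b k⌉) contribute at most
-- Top(k), and the geometric tail below level L at most k λ^(L+1) ≤ b^L λ^L ≤ Top(k).
module Submission where

open import Defs
open import Data.Nat as ℕ using (ℕ; zero; suc; z≤n; s≤s)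
import Data.Nat.Properties as ℕP
open import Data.Nat.Divisibility using (_∣_; ∣1⇒≡1; ∣m+n∣m⇒∣n; m∣m*n)
import Data.Integer as ℤ
import Data.Integer.Properties as ℤP
open import Data.Rational as ℚ using (ℚ; 0ℚ; 1ℚ; _+_; _-_; _*_; _≤_; _<_)
open import Data.Rational.Unnormalised as ℚᵘ using (ℚᵘ; mkℚᵘ; *≡*)
import Data.Rational.Unnormalised.Properties as ℚᵘP
import Data.Rational.Properties as ℚP
open import Data.Rational.Solver using (module +-*-Solver)
open import Data.Fin using (Fin) renaming (_≟_ to _≟ᶠ_)
open import Data.List using (List; []; _∷_; _++_; [_]; length; map; allFin)
import Data.List.Properties as ListP
open import Data.List.Relation.Unary.All as All using (All; []; _∷_)
import Data.List.Relation.Unary.All.Properties as AllP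
import Data.List.Relation.Unary.Any as Any
open import Data.List.Membership.Propositional using (_∈_)
open import Data.List.Membership.Propositional.Properties using (∈-allFin)
open import Data.List.Relation.Binary.Permutation.Propositional
  using (_↭_; ↭-refl; ↭-trans; ↭-prep; ↭-reflexive; module PermutationReasoning)
import Data.List.Relation.Binary.Permutation.Propositional.Properties as ↭P
open import Data.Product using (Σ; Σ-syntax; _×_; _,_; proj₁; proj₂)
open import Data.Unit using (⊤; tt)
open import Data.Empty using (⊥-elim)
open import Function using (_∘_)
open import Relation.Nullary using (Dec; yes; no)
open import Relation.Binary.PropositionalEquality hiding ([_])

ℕ→ℚ-+ : ∀ m n → ℕ→ℚ (m ℕ.+ n) ≡ ℕ→ℚ m + ℕ→ℚ n
ℕ→ℚ-+ m n = ℚP.toℚᵘ-injective (begin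
  ℚ.toℚᵘ (ℕ→ℚ (m ℕ.+ n))              ≈⟨ ℚP.toℚᵘ-fromℚᵘ (ℕ→ℚᵘ (m ℕ.+ n)) ⟩
  ℕ→ℚᵘ (m ℕ.+ n)                       ≈⟨ *≡* (cong (ℤ._* ℤ.+ 1) +-homo) ⟩
  ℕ→ℚᵘ m ℚᵘ.+ ℕ→ℚᵘ n                   ≈⟨ ℚᵘP.+-cong (ℚP.toℚᵘ-fromℚᵘ (ℕ→ℚᵘ m))
                                                    (ℚP.toℚᵘ-fromℚᵘ (ℕ→ℚᵘ n)) ⟨
  ℚ.toℚᵘ (ℕ→ℚ m) ℚᵘ.+ ℚ.toℚᵘ (ℕ→ℚ n)  ≈⟨ ℚP.toℚᵘ-homo-+ (ℕ→ℚ m) (ℕ→ℚ n) ⟨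
  ℚ.toℚᵘ (ℕ→ℚ m + ℕ→ℚ n)              ∎)
  where
  open ℚᵘP.≃-Reasoning
  ℕ→ℚᵘ : ℕ → ℚᵘ
  ℕ→ℚᵘ k = mkℚᵘ (ℤ.+ k) 0
  +-homo : ℤ.+ (m ℕ.+ n) ≡ ℤ.+ m ℤ.* ℤ.+ 1 ℤ.+ ℤ.+ n ℤ.* ℤ.+ 1
  +-homo = trans (ℤP.pos-+ m n)
    (sym (cong₂ ℤ._+_ (ℤP.*-identityʳ (ℤ.+ m)) (ℤP.*-identityʳ (ℤ.+ n))))

ℕ→ℚ-nonNeg : ∀ n → 0ℚ ≤ ℕ→ℚ n
ℕ→ℚ-nonNeg n = ℚP.nonNegative⁻¹ (ℕ→ℚ n) {{ℚP.normalize-nonNeg n 1}}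

p≤p+q : ∀ p {q} → 0ℚ ≤ q → p ≤ p + q
p≤p+q p {q} 0≤q = subst (_≤ p + q) (ℚP.+-identityʳ p) (ℚP.+-monoʳ-≤ p 0≤q)

p≤q+p : ∀ p {q} → 0ℚ ≤ q → p ≤ q + p
p≤q+p p {q} 0≤q = subst (p ≤_) (ℚP.+-comm p q) (p≤p+q p 0≤q)

ℕ→ℚ-mono-≤ : ∀ {m n} → m ℕ.≤ n → ℕ→ℚ m ≤ ℕ→ℚ n
ℕ→ℚ-mono-≤ {m} {n} m≤n = subst (ℕ→ℚ m ≤_)
  (trans (sym (ℕ→ℚ-+ m (n ℕ.∸ m))) (cong ℕ→ℚ (ℕP.m+[n∸m]≡n m≤n)))
  (p≤p+q (ℕ→ℚ m) (ℕ→ℚ-nonNeg (n ℕ.∸ m)))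

+-nonNeg : ∀ {p q} → 0ℚ ≤ p → 0ℚ ≤ q → 0ℚ ≤ p + q
+-nonNeg {p} 0≤p 0≤q = ℚP.≤-trans 0≤p (p≤p+q p 0≤q)

*-monoˡ-≤ : ∀ r {p q} → 0ℚ ≤ r → p ≤ q → r * p ≤ r * q
*-monoˡ-≤ r 0≤r = ℚP.*-monoˡ-≤-nonNeg r {{ℚ.nonNegative 0≤r}}

*-monoʳ-≤ : ∀ r {p q} → 0ℚ ≤ r → p ≤ q → p * r ≤ q * r
*-monoʳ-≤ r 0≤r = ℚP.*-monoʳ-≤-nonNeg r {{ℚ.nonNegative 0≤r}}

*-nonNeg : ∀ {p q} → 0ℚ ≤ p → 0ℚ ≤ q → 0ℚ ≤ p * q
*-nonNeg {p} 0≤p 0≤q = subst (_≤ p * _) (ℚP.*-zeroʳ p) (*-monoˡ-≤ p 0≤p 0≤q)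

^ℚ-nonNeg : ∀ {q} n → 0ℚ ≤ q → 0ℚ ≤ q ^ℚ n
^ℚ-nonNeg zero    0≤q = ℕ→ℚ-nonNeg 1
^ℚ-nonNeg (suc n) 0≤q = *-nonNeg 0≤q (^ℚ-nonNeg n 0≤q)

distFrom≤climb+climb : ∀ {b λ'} → 0ℚ ≤ λ' → ∀ d (xs ys : List (Fin b)) →
  distFrom λ' d xs ys ≤ climb λ' d xs + climb λ' d ys
distFrom≤climb+climb 0≤λ d []       ys       = ℚP.≤-reflexive (sym (ℚP.+-identityˡ _))
distFrom≤climb+climb 0≤λ d (x ∷ xs) []       = ℚP.≤-reflexive (sym (ℚP.+-identityʳ _))
distFrom≤climb+climb 0≤λ d (x ∷ xs) (y ∷ ys) with x ≟ᶠ y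
... | no  _ = ℚP.≤-refl
... | yes _ = ℚP.≤-trans (distFrom≤climb+climb 0≤λ (suc d) xs ys)
  (ℚP.+-mono-≤ (p≤q+p _ (^ℚ-nonNeg (suc d) 0≤λ)) (p≤q+p _ (^ℚ-nonNeg (suc d) 0≤λ)))

distFrom-++ : ∀ {b} λ' d (p xs ys : List (Fin b)) →
  distFrom λ' d (p ++ xs) (p ++ ys) ≡ distFrom λ' (d ℕ.+ length p) xs ys
distFrom-++ λ' d []      xs ys = cong (λ e → distFrom λ' e xs ys) (sym (ℕP.+-identityʳ d))
distFrom-++ λ' d (c ∷ p) xs ys with c ≟ᶠ c
... | no  c≢c = ⊥-elim (c≢c refl)
... | yes _   = trans (distFrom-++ λ' (suc d) p xs ys)
                      (cong (λ e → distFrom λ' e xs ys) (sym (ℕP.+-suc d (length p))))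

n<b^n : ∀ {b} → 2 ℕ.≤ b → ∀ n → n ℕ.< b ℕ.^ n
n<b^n     2≤b zero    = s≤s z≤n
n<b^n {b} 2≤b (suc n) = begin-strict
  suc n                ≡⟨ ℕP.+-comm 1 n ⟩
  n ℕ.+ 1              <⟨ ℕP.+-mono-<-≤ (n<b^n 2≤b n) (ℕP.≤-trans (s≤s z≤n) (n<b^n 2≤b n)) ⟩
  b ℕ.^ n ℕ.+ b ℕ.^ n  ≡⟨ cong (b ℕ.^ n ℕ.+_) (ℕP.+-identityʳ (b ℕ.^ n)) ⟨
  2 ℕ.* b ℕ.^ n        ≤⟨ ℕP.*-monoˡ-≤ (b ℕ.^ n) 2≤b ⟩
  b ℕ.^ suc n          ∎
  where open ℕP.≤-Reasoning

ceilLogFrom-spec : ∀ {b k} m fuel → k ℕ.≤ b ℕ.^ (m ℕ.+ fuel) → k ℕ.≤ b ℕ.^ ceilLogFrom b k m fuel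
ceilLogFrom-spec {b} {k} m zero       k≤ = subst (λ e → k ℕ.≤ b ℕ.^ e) (ℕP.+-identityʳ m) k≤
ceilLogFrom-spec {b} {k} m (suc fuel) k≤ with k ℕP.≤? b ℕ.^ m
... | yes k≤b^m = k≤b^m
... | no  _     = ceilLogFrom-spec (suc m) fuel (subst (λ e → k ℕ.≤ b ℕ.^ e) (ℕP.+-suc m fuel) k≤)

ceilLog-spec : ∀ {b} → 2 ℕ.≤ b → ∀ k → k ℕ.≤ b ℕ.^ ceilLog b k
ceilLog-spec 2≤b k = ceilLogFrom-spec 0 k (ℕP.<⇒≤ (n<b^n 2≤b k))

levelCost : ℚ → ℕ → ℕ → (ℕ → ℕ) → ℚ
levelCost λ' d zero    c = 0ℚ
levelCost λ' d (suc h) c = ℕ→ℚ (c 0) * (λ' ^ℚ suc d) + levelCost λ' (suc d) h (c ∘ suc)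

levelCost-zero : ∀ λ' d h → levelCost λ' d h (λ _ → 0) ≡ 0ℚ
levelCost-zero λ' d zero    = refl
levelCost-zero λ' d (suc h) = trans (cong (ℕ→ℚ 0 * (λ' ^ℚ suc d) +_) (levelCost-zero λ' (suc d) h))
  (trans (ℚP.+-identityʳ _) (ℚP.*-zeroˡ (λ' ^ℚ suc d)))

levelCost-+ : ∀ λ' d h c c' →
  levelCost λ' d h (λ j → c j ℕ.+ c' j) ≡ levelCost λ' d h c + levelCost λ' d h c'
levelCost-+ λ' d zero    c c' = sym (ℚP.+-identityˡ 0ℚ)
levelCost-+ λ' d (suc h) c c' = begin
  ℕ→ℚ (c 0 ℕ.+ c' 0) * X + levelCost λ' (suc d) h (λ j → c (suc j) ℕ.+ c' (suc j))
    ≡⟨ cong₂ (λ k r → k * X + r) (ℕ→ℚ-+ (c 0) (c' 0))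
             (levelCost-+ λ' (suc d) h (c ∘ suc) (c' ∘ suc)) ⟩
  (ℕ→ℚ (c 0) + ℕ→ℚ (c' 0)) * X + (W + W')
    ≡⟨ solve 5 (λ k k' x r r' → (k :+ k') :* x :+ (r :+ r') := (k :* x :+ r) :+ (k' :* x :+ r'))
         refl (ℕ→ℚ (c 0)) (ℕ→ℚ (c' 0)) X W W' ⟩
  levelCost λ' d (suc h) c + levelCost λ' d (suc h) c' ∎
  where
  open ≡-Reasoning
  open +-*-Solver
  X = λ' ^ℚ suc d
  W = levelCost λ' (suc d) h (c ∘ suc)
  W' = levelCost λ' (suc d) h (c' ∘ suc)

-- q is within the cost of count j edges on each level d+1+j, where count j ≤ min (w·b^j, n):
-- as many as w subtrees of height h hanging at level d, holding n points, can use.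
record LevelBound (b : ℕ) (λ' : ℚ) (w n d h : ℕ) (q : ℚ) : Set where
  constructor levelBound
  field
    count       : ℕ → ℕ
    count≤width : ∀ j → count j ℕ.≤ w ℕ.* b ℕ.^ j
    count≤size  : ∀ j → count j ℕ.≤ n
    bounded     : q ≤ levelCost λ' d h count

module _ {b : ℕ} {λ' : ℚ} where

  LevelBound-zero : ∀ {w n d h} → LevelBound b λ' w n d h 0ℚ
  LevelBound-zero {d = d} {h} =
    levelBound (λ _ → 0) (λ _ → z≤n) (λ _ → z≤n) (ℚP.≤-reflexive (sym (levelCost-zero λ' d h)))

  LevelBound-≤ : ∀ {w n d h q q'} → q ≤ q' → LevelBound b λ' w n d h q' →
    LevelBound b λ' w n d h q
  LevelBound-≤ q≤q' (levelBound c c≤w c≤n q'≤) = levelBound c c≤w c≤n (ℚP.≤-trans q≤q' q'≤)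

  LevelBound-+ : ∀ {w w' n n' d h q q'} →
    LevelBound b λ' w n d h q → LevelBound b λ' w' n' d h q' →
    LevelBound b λ' (w ℕ.+ w') (n ℕ.+ n') d h (q + q')
  LevelBound-+ {w} {w'} {d = d} {h} (levelBound c c≤w c≤n q≤) (levelBound c' c'≤w' c'≤n' q'≤) =
    levelBound (λ j → c j ℕ.+ c' j)
      (λ j → ℕP.≤-trans (ℕP.+-mono-≤ (c≤w j) (c'≤w' j))
                        (ℕP.≤-reflexive (sym (ℕP.*-distribʳ-+ (b ℕ.^ j) w w'))))
      (λ j → ℕP.+-mono-≤ (c≤n j) (c'≤n' j))
      (ℚP.≤-trans (ℚP.+-mono-≤ q≤ q'≤) (ℚP.≤-reflexive (sym (levelCost-+ λ' d h c c'))))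

  -- A subtree hung one level lower, whose u ≤ 1 leftover points climb one more edge.
  LevelBound-push : ∀ {n d h q u} → u ℕ.≤ 1 → u ℕ.≤ n → LevelBound b λ' b n (suc d) h q →
    LevelBound b λ' 1 n d (suc h) (ℕ→ℚ u * (λ' ^ℚ suc d) + q)
  LevelBound-push {n} {u = u} u≤1 u≤n (levelBound c c≤w c≤n q≤) =
    levelBound count count≤b^ count≤n (ℚP.+-monoʳ-≤ (ℕ→ℚ u * _) q≤)
    where
    count : ℕ → ℕ
    count zero    = u
    count (suc j) = c j
    count≤b^ : ∀ j → count j ℕ.≤ 1 ℕ.* b ℕ.^ j
    count≤b^ zero    = u≤1
    count≤b^ (suc j) = ℕP.≤-trans (c≤w j) (ℕP.≤-reflexive (sym (ℕP.*-identityˡ (b ℕ.^ suc j))))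
    count≤n : ∀ j → count j ℕ.≤ n
    count≤n zero    = u≤n
    count≤n (suc j) = c≤n j

module GreedyMatching (b δ : ℕ) (λ' : ℚ) (0≤λ : 0ℚ ≤ λ') where

  Point : Set
  Point = Vertex b δ

  -- A point still to be matched, paired with its path below the current vertex.
  Pending : Set
  Pending = Point × List (Fin b)

  points : List Pending → List Point
  points = map proj₁

  Below : List (Fin b) → Pending → Set
  Below p ((path , _) , s) = path ≡ p ++ s

  charge : ℕ → List Pending → ℚ
  charge d []             = 0ℚ
  charge d ((_ , s) ∷ xs) = climb λ' d s + charge d xs

  dist-below : ∀ {p d} → length p ≡ d → ∀ {x y} → Below p x → Below p y →
    dist λ' (proj₁ x) (proj₁ y) ≤ climb λ' d (proj₂ x) + climb λ' d (proj₂ y)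
  dist-below {p} refl {(_ , _) , s} {(_ , _) , t} refl refl =
    subst (_≤ climb λ' (length p) s + climb λ' (length p) t) (sym (distFrom-++ λ' 0 p s t))
      (distFrom≤climb+climb 0≤λ (length p) s t)

  matchingCost-++ : ∀ (ms ms' : List (Point × Point)) →
    matchingCost λ' (ms ++ ms') ≡ matchingCost λ' ms + matchingCost λ' ms'
  matchingCost-++ []             ms' = sym (ℚP.+-identityˡ _)
  matchingCost-++ ((u , v) ∷ ms) ms' = trans (cong (dist λ' u v +_) (matchingCost-++ ms ms'))
    (sym (ℚP.+-assoc (dist λ' u v) _ _))

  flatten-++ : ∀ (ms ms' : List (Point × Point)) → flatten (ms ++ ms') ≡ flatten ms ++ flatten ms'
  flatten-++ []             ms' = refl
  flatten-++ ((u , v) ∷ ms) ms' = cong (λ l → u ∷ v ∷ l) (flatten-++ ms ms')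

  length-flatten : ∀ (ms : List (Point × Point)) → length (flatten ms) ≡ 2 ℕ.* length ms
  length-flatten []       = refl
  length-flatten (_ ∷ ms) = trans (cong (suc ∘ suc) (length-flatten ms))
    (sym (ℕP.*-suc 2 (length ms)))

  charge-++ : ∀ d (xs ys : List Pending) → charge d (xs ++ ys) ≡ charge d xs + charge d ys
  charge-++ d []             ys = sym (ℚP.+-identityˡ _)
  charge-++ d ((_ , s) ∷ xs) ys = trans (cong (climb λ' d s +_) (charge-++ d xs ys))
    (sym (ℚP.+-assoc (climb λ' d s) _ _))

  charge-atVertex : ∀ d (xs : List Pending) → All (λ x → proj₂ x ≡ []) xs → charge d xs ≡ 0ℚ
  charge-atVertex d []       []          = refl
  charge-atVertex d (_ ∷ xs) (refl ∷ es) = trans (ℚP.+-identityˡ _) (charge-atVertex d xs es)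

  record PartialMatching (p : List (Fin b)) (pts : List Point) : Set where
    constructor partialMatching
    field
      pairs     : List (Point × Point)
      unmatched : List Pending
      covers    : flatten pairs ++ points unmatched ↭ pts
      below     : All (Below p) unmatched

  open PartialMatching

  residual : ∀ {p pts} → ℕ → PartialMatching p pts → ℚ
  residual d m = matchingCost λ' (pairs m) + charge d (unmatched m)

  length-unmatched≤ : ∀ {p pts} (m : PartialMatching p pts) → length (unmatched m) ℕ.≤ length pts
  length-unmatched≤ {pts = pts} m = begin
    length (unmatched m)
      ≡⟨ ListP.length-map proj₁ (unmatched m) ⟨
    length (points (unmatched m))
      ≤⟨ ListP.length-++-≤ʳ (points (unmatched m)) {flatten (pairs m)} ⟩
    length (flatten (pairs m) ++ points (unmatched m))
      ≡⟨ ↭P.↭-length (covers m) ⟩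
    length pts ∎
    where open ℕP.≤-Reasoning

  unmatchedAll : ∀ {p} (xs : List Pending) → All (Below p) xs → PartialMatching p (points xs)
  unmatchedAll xs bs = partialMatching [] xs ↭-refl bs

  addPair : ∀ {p pts} u v → PartialMatching p pts → PartialMatching p (u ∷ v ∷ pts)
  addPair u v m =
    partialMatching ((u , v) ∷ pairs m) (unmatched m) (↭-prep u (↭-prep v (covers m))) (below m)

  relabel : ∀ {p pts pts'} → pts ↭ pts' → PartialMatching p pts → PartialMatching p pts'
  relabel pts↭pts' m =
    partialMatching (pairs m) (unmatched m) (↭-trans (covers m) pts↭pts') (below m)

  infixr 5 _∪_
  _∪_ : ∀ {p pts pts'} → PartialMatching p pts → PartialMatching p pts' →
    PartialMatching p (pts ++ pts')
  _∪_ {pts = pts} {pts'} m m' =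
    partialMatching (pairs m ++ pairs m') (unmatched m ++ unmatched m') covers∪
      (AllP.++⁺ (below m) (below m'))
    where
    open PermutationReasoning
    f = flatten (pairs m)
    f' = flatten (pairs m')
    q = points (unmatched m)
    q' = points (unmatched m')
    covers∪ : flatten (pairs m ++ pairs m') ++ points (unmatched m ++ unmatched m') ↭ pts ++ pts'
    covers∪ = begin
      flatten (pairs m ++ pairs m') ++ points (unmatched m ++ unmatched m')
        ≡⟨ cong₂ _++_ (flatten-++ (pairs m) (pairs m'))
                      (ListP.map-++ proj₁ (unmatched m) (unmatched m')) ⟩
      (f ++ f') ++ (q ++ q')   ≡⟨ ListP.++-assoc f f' (q ++ q') ⟩
      f ++ (f' ++ (q ++ q'))   ↭⟨ ↭P.++⁺ˡ f (↭P.shifts f' q) ⟩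
      f ++ (q ++ (f' ++ q'))   ≡⟨ ListP.++-assoc f q (f' ++ q') ⟨
      (f ++ q) ++ (f' ++ q')   ↭⟨ ↭P.++⁺ (covers m) (covers m') ⟩
      pts ++ pts'              ∎

  refine : ∀ {p pts} (m : PartialMatching p pts) → PartialMatching p (points (unmatched m)) →
    PartialMatching p pts
  refine {pts = pts} m m' = partialMatching (pairs m ++ pairs m') (unmatched m') covers' (below m')
    where
    open PermutationReasoning
    f = flatten (pairs m)
    f' = flatten (pairs m')
    q' = points (unmatched m')
    covers' : flatten (pairs m ++ pairs m') ++ q' ↭ pts
    covers' = begin
      flatten (pairs m ++ pairs m') ++ q'  ≡⟨ cong (_++ q') (flatten-++ (pairs m) (pairs m')) ⟩
      (f ++ f') ++ q'                      ≡⟨ ListP.++-assoc f f' q' ⟩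
      f ++ (f' ++ q')                      ↭⟨ ↭P.++⁺ˡ f (covers m') ⟩
      f ++ points (unmatched m)            ↭⟨ covers m ⟩
      pts                                  ∎

  extend : Fin b → Pending → Pending
  extend c (a , s) = a , c ∷ s

  lift : ∀ {p pts} (c : Fin b) → PartialMatching (p ++ [ c ]) pts → PartialMatching p pts
  lift {p} {pts} c m = partialMatching (pairs m) (map (extend c) (unmatched m))
    (subst (λ q → flatten (pairs m) ++ q ↭ pts) (ListP.map-∘ (unmatched m)) (covers m))
    (AllP.gmap⁺ (λ {x} → extend-below {x}) (below m))
    where
    extend-below : ∀ {x} → Below (p ++ [ c ]) x → Below p (extend c x)
    extend-below {(_ , _) , s} e = trans e (ListP.++-assoc p [ c ] s)

  open +-*-Solver

  residual-∪ : ∀ {p pts pts'} d (m : PartialMatching p pts) (m' : PartialMatching p pts') →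
    residual d (m ∪ m') ≡ residual d m + residual d m'
  residual-∪ d m m' = trans
    (cong₂ _+_ (matchingCost-++ (pairs m) (pairs m')) (charge-++ d (unmatched m) (unmatched m')))
    (solve 4 (λ c c' h h' → (c :+ c') :+ (h :+ h') := (c :+ h) :+ (c' :+ h')) refl
      (matchingCost λ' (pairs m)) (matchingCost λ' (pairs m'))
      (charge d (unmatched m)) (charge d (unmatched m')))

  residual-refine-≤ : ∀ {p pts} d (m : PartialMatching p pts)
    (m' : PartialMatching p (points (unmatched m))) →
    residual d m' ≤ charge d (unmatched m) → residual d (refine m m') ≤ residual d m
  residual-refine-≤ d m m' m'≤ = begin
    matchingCost λ' (pairs m ++ pairs m') + charge d (unmatched m')
      ≡⟨ cong (_+ charge d (unmatched m')) (matchingCost-++ (pairs m) (pairs m')) ⟩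
    (matchingCost λ' (pairs m) + matchingCost λ' (pairs m')) + charge d (unmatched m')
      ≡⟨ ℚP.+-assoc (matchingCost λ' (pairs m)) _ _ ⟩
    matchingCost λ' (pairs m) + residual d m'
      ≤⟨ ℚP.+-monoʳ-≤ (matchingCost λ' (pairs m)) m'≤ ⟩
    residual d m ∎
    where open ℚP.≤-Reasoning

  charge-extend : ∀ d c (xs : List Pending) →
    charge d (map (extend c) xs) ≡ ℕ→ℚ (length xs) * (λ' ^ℚ suc d) + charge (suc d) xs
  charge-extend d c []             = sym (trans (ℚP.+-identityʳ _) (ℚP.*-zeroˡ (λ' ^ℚ suc d)))
  charge-extend d c ((a , s) ∷ xs) = begin
    (X + S) + charge d (map (extend c) xs)  ≡⟨ cong ((X + S) +_) (charge-extend d c xs) ⟩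
    (X + S) + (n * X + charge (suc d) xs)   ≡⟨ shuffle X S n (charge (suc d) xs) ⟩
    (1ℚ + n) * X + (S + charge (suc d) xs)  ≡⟨ cong (λ k → k * X + (S + charge (suc d) xs))
                                                    (ℕ→ℚ-+ 1 (length xs)) ⟨
    ℕ→ℚ (suc (length xs)) * X + (S + charge (suc d) xs) ∎
    where
    open ≡-Reasoning
    X = λ' ^ℚ suc d
    S = climb λ' (suc d) s
    n = ℕ→ℚ (length xs)
    shuffle : ∀ x a k r → (x + a) + (k * x + r) ≡ (1ℚ + k) * x + (a + r)
    shuffle = solve 4 (λ x a k r → (x :+ a) :+ (k :* x :+ r) := (con 1ℚ :+ k) :* x :+ (a :+ r)) refl

  residual-lift : ∀ {p pts} d c (m : PartialMatching (p ++ [ c ]) pts) →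
    residual d (lift c m) ≡ ℕ→ℚ (length (unmatched m)) * (λ' ^ℚ suc d) + residual (suc d) m
  residual-lift d c m =
    trans (cong (matchingCost λ' (pairs m) +_) (charge-extend d c (unmatched m)))
      (solve 3 (λ a x r → a :+ (x :+ r) := x :+ (a :+ r)) refl (matchingCost λ' (pairs m))
        (ℕ→ℚ (length (unmatched m)) * (λ' ^ℚ suc d)) (charge (suc d) (unmatched m)))

  pairUp : ∀ {p d} → length p ≡ d → (xs : List Pending) → All (Below p) xs →
    Σ[ m ∈ PartialMatching p (points xs) ] length (unmatched m) ℕ.≤ 1 × residual d m ≤ charge d xs
  pairUp _ []       [] = unmatchedAll [] [] , z≤n , ℚP.≤-reflexive (ℚP.+-identityˡ _)
  pairUp _ (x ∷ []) bs = unmatchedAll (x ∷ []) bs , ℕP.≤-refl , ℚP.≤-reflexive (ℚP.+-identityˡ _)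
  pairUp {d = d} eq (x ∷ y ∷ xs) (bx ∷ by ∷ bs) with pairUp eq xs bs
  ... | m , ≤1 , m≤ = addPair (proj₁ x) (proj₁ y) m , ≤1 , (begin
      (D + matchingCost λ' (pairs m)) + charge d (unmatched m)  ≡⟨ ℚP.+-assoc D _ _ ⟩
      D + residual d m                 ≤⟨ ℚP.+-mono-≤ (dist-below eq {x} {y} bx by) m≤ ⟩
      (cx + cy) + charge d xs          ≡⟨ ℚP.+-assoc cx cy _ ⟩
      cx + (cy + charge d xs)          ∎)
    where
    open ℚP.≤-Reasoning
    D = dist λ' (proj₁ x) (proj₁ y)
    cx = climb λ' d (proj₂ x)
    cy = climb λ' d (proj₂ y)

  Inside : List (Fin b) → ℕ → Pending → Set
  Inside p h x = Below p x × length (proj₂ x) ℕ.≤ h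

  Greedy : List (Fin b) → ℕ → ℕ → List Pending → Set
  Greedy p d h xs = Σ[ m ∈ PartialMatching p (points xs) ]
    length (unmatched m) ℕ.≤ 1 × LevelBound b λ' b (length (points xs)) d h (residual d m)

  GreedyAt : ℕ → Set
  GreedyAt h = ∀ p d → length p ≡ d → (xs : List Pending) → All (Inside p h) xs → Greedy p d h xs

  HeadIn : List (Fin b) → List (Fin b) → Set
  HeadIn cs []      = ⊤
  HeadIn cs (c ∷ _) = c ∈ cs

  record ChildSplit (p : List (Fin b)) (c : Fin b) (h : ℕ) (cs : List (Fin b))
                    (xs : List Pending) : Set where
    constructor childSplit
    field
      child others  : List Pending
      split↭        : points child ++ points others ↭ points xs
      child-inside  : All (Inside (p ++ [ c ]) h) child
      others-inside : All (Inside p (suc h)) others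
      others-heads  : All (HeadIn cs ∘ proj₂) others

  splitChild : ∀ p c h cs (xs : List Pending) →
    All (Inside p (suc h)) xs → All (HeadIn (c ∷ cs) ∘ proj₂) xs → ChildSplit p c h cs xs
  splitChild p c h cs [] [] [] = childSplit [] [] ↭-refl [] [] []
  splitChild p c h cs ((a , []) ∷ xs) (ins ∷ inss) (_ ∷ heads)
    with splitChild p c h cs xs inss heads
  ... | childSplit G R G++R↭xs insG insR headsR =
    childSplit G ((a , []) ∷ R) (↭-trans (↭P.shift a (points G) (points R)) (↭-prep a G++R↭xs))
      insG (ins ∷ insR) (tt ∷ headsR)
  splitChild p c h cs ((a , c' ∷ s) ∷ xs) ((below , len) ∷ inss) (c'∈ ∷ heads)
    with splitChild p c h cs xs inss heads | c' ≟ᶠ c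
  ... | childSplit G R G++R↭xs insG insR headsR | yes refl =
    childSplit ((a , s) ∷ G) R (↭-prep a G++R↭xs)
      ((trans below (sym (ListP.++-assoc p [ c ] s)) , ℕP.≤-pred len) ∷ insG) insR headsR
  ... | childSplit G R G++R↭xs insG insR headsR | no c'≢c =
    childSplit G ((a , c' ∷ s) ∷ R) (↭-trans (↭P.shift a (points G) (points R)) (↭-prep a G++R↭xs))
      insG ((below , len) ∷ insR) (Any.tail c'≢c c'∈ ∷ headsR)

  atVertex-heads : ∀ (xs : List Pending) → All (HeadIn [] ∘ proj₂) xs → All (λ x → proj₂ x ≡ []) xs
  atVertex-heads []                 []          = []
  atVertex-heads ((_ , []) ∷ xs)    (_ ∷ heads) = refl ∷ atVertex-heads xs heads
  atVertex-heads ((_ , _ ∷ _) ∷ xs) (() ∷ _)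

  atVertex-inside : ∀ {p} (xs : List Pending) → All (Inside p 0) xs → All (λ x → proj₂ x ≡ []) xs
  atVertex-inside []                 []             = []
  atVertex-inside ((_ , []) ∷ xs)    (_ ∷ inss)     = refl ∷ atVertex-inside xs inss
  atVertex-inside ((_ , _ ∷ _) ∷ xs) ((_ , ()) ∷ _)

  heads-allFin : ∀ (xs : List Pending) → All (HeadIn (allFin b) ∘ proj₂) xs
  heads-allFin []                 = []
  heads-allFin ((_ , []) ∷ xs)    = tt ∷ heads-allFin xs
  heads-allFin ((_ , c ∷ _) ∷ xs) = ∈-allFin c ∷ heads-allFin xs

  -- Matches inside the child subtrees with an index in cs only; the points at the vertex itself
  -- and the (at most one per child) leftovers of the children stay unmatched.
  children : ∀ {h} → GreedyAt h → ∀ p d → length p ≡ d → (cs : List (Fin b)) (xs : List Pending) →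
    All (Inside p (suc h)) xs → All (HeadIn cs ∘ proj₂) xs →
    Σ[ m ∈ PartialMatching p (points xs) ]
      LevelBound b λ' (length cs) (length (points xs)) d (suc h) (residual d m)
  children greedy p d eq [] xs inss heads = unmatchedAll xs (All.map proj₁ inss) ,
    LevelBound-≤ (ℚP.≤-reflexive (trans (ℚP.+-identityˡ _)
                                        (charge-atVertex d xs (atVertex-heads xs heads))))
      LevelBound-zero
  children {h} greedy p d eq (c ∷ cs) xs inss heads with splitChild p c h cs xs inss heads
  ... | childSplit G R G++R↭xs insG insR headsR
    with greedy (p ++ [ c ]) (suc d) eq' G insG | children greedy p d eq cs R insR headsR
    where eq' = trans (ListP.length-++ p) (trans (ℕP.+-comm (length p) 1) (cong suc eq))
  ... | mG , ≤1 , boundG | mR , boundR =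
    relabel G++R↭xs (lift c mG ∪ mR) ,
    subst (λ n → LevelBound b λ' (suc (length cs)) n d (suc h) (residual d (lift c mG ∪ mR))) sizes
      (LevelBound-≤ (ℚP.≤-reflexive residual≡)
        (LevelBound-+ (LevelBound-push ≤1 (length-unmatched≤ mG) boundG) boundR))
    where
    sizes : length (points G) ℕ.+ length (points R) ≡ length (points xs)
    sizes = trans (sym (ListP.length-++ (points G))) (↭P.↭-length G++R↭xs)
    residual≡ : residual d (lift c mG ∪ mR) ≡
      (ℕ→ℚ (length (unmatched mG)) * (λ' ^ℚ suc d) + residual (suc d) mG) + residual d mR
    residual≡ = trans (residual-∪ d (lift c mG) mR) (cong (_+ residual d mR) (residual-lift d c mG))

  greedy : ∀ h → GreedyAt h
  greedy zero p d eq xs inss with pairUp eq xs (All.map proj₁ inss)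
  ... | m , ≤1 , m≤ = m , ≤1 ,
    LevelBound-≤ (ℚP.≤-trans m≤ (ℚP.≤-reflexive (charge-atVertex d xs (atVertex-inside xs inss))))
      LevelBound-zero
  greedy (suc h) p d eq xs inss with children (greedy h) p d eq (allFin b) xs inss (heads-allFin xs)
  ... | m , bound with pairUp eq (unmatched m) (below m)
  ... | m' , ≤1 , m'≤ = refine m m' , ≤1 ,
    subst (λ w → LevelBound b λ' w (length (points xs)) d (suc h) (residual d (refine m m')))
      length-allFin (LevelBound-≤ (residual-refine-≤ d m m' m'≤) bound)
    where
    length-allFin : length (allFin b) ≡ b
    length-allFin = ListP.length-tabulate (λ i → i)

  length-odd : ∀ {ms a pts} → flatten ms ++ [ a ] ↭ pts → length pts ≡ 2 ℕ.* length ms ℕ.+ 1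
  length-odd {ms} covers = trans (sym (↭P.↭-length covers))
    (trans (ListP.length-++ (flatten ms)) (cong (ℕ._+ 1) (length-flatten ms)))

  unmatched-even : ∀ {p pts} (m : PartialMatching p pts) → length (unmatched m) ℕ.≤ 1 →
    2 ∣ length pts → unmatched m ≡ []
  unmatched-even (partialMatching ms []          covers _) _ _ = refl
  unmatched-even (partialMatching ms (_ ∷ _ ∷ _) covers _) (s≤s ()) _
  unmatched-even (partialMatching ms (_ ∷ [])    covers _) _ 2∣pts
    with ∣1⇒≡1 (∣m+n∣m⇒∣n (subst (2 ∣_) (length-odd {ms} covers) 2∣pts) (m∣m*n (length ms)))
  ... | ()

  unmatched≡[]⇒perfect : ∀ {p pts} d (m : PartialMatching p pts) → unmatched m ≡ [] →
    IsPerfectMatching (pairs m) pts × matchingCost λ' (pairs m) ≡ residual d m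
  unmatched≡[]⇒perfect d (partialMatching ms [] covers _) refl =
    ↭-trans (↭-reflexive (sym (ListP.++-identityʳ (flatten ms)))) covers , sym (ℚP.+-identityʳ _)

  atRoot : Point → Pending
  atRoot a = a , proj₁ a

  points-atRoot : ∀ pts → points (map atRoot pts) ≡ pts
  points-atRoot pts = trans (sym (ListP.map-∘ pts)) (ListP.map-id pts)

  perfectMatching : (pts : List Point) → 2 ∣ length pts →
    Σ[ ms ∈ List (Point × Point) ]
      IsPerfectMatching ms pts × LevelBound b λ' b (length pts) 0 δ (matchingCost λ' ms)
  perfectMatching pts 2∣pts
    with greedy δ [] 0 refl (map atRoot pts) (AllP.map⁺ (All.tabulate (λ {a} _ → refl , proj₂ a)))
  ... | m₀ , ≤1 , bound with unmatched≡[]⇒perfect 0 m (unmatched-even m ≤1 2∣pts)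
    where m = relabel (↭-reflexive (points-atRoot pts)) m₀
  ... | perfect , cost≡ = pairs m₀ , perfect ,
    subst (λ n → LevelBound b λ' b n 0 δ (matchingCost λ' (pairs m₀)))
      (cong length (points-atRoot pts)) (LevelBound-≤ (ℚP.≤-reflexive cost≡) bound)

module LevelCosts {b : ℕ} {λ' : ℚ} (0≤λ : 0ℚ ≤ λ') (λ≤1 : λ' ≤ 1ℚ) where

  open ℚP.≤-Reasoning
  open +-*-Solver

  0≤1-λ : 0ℚ ≤ 1ℚ - λ'
  0≤1-λ = ℚP.≤-trans (ℚP.≤-reflexive (sym (ℚP.+-inverseʳ λ'))) (ℚP.+-monoˡ-≤ (ℚ.- λ') λ≤1)

  *[1-λ]-≤ : ∀ {x} → 0ℚ ≤ x → x * (1ℚ - λ') ≤ x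
  *[1-λ]-≤ {x} 0≤x = begin
    x * (1ℚ - λ')  ≤⟨ *-monoˡ-≤ x 0≤x 1-λ≤1 ⟩
    x * 1ℚ         ≡⟨ ℚP.*-identityʳ x ⟩
    x              ∎
    where
    1-λ≤1 : 1ℚ - λ' ≤ 1ℚ
    1-λ≤1 = ℚP.≤-trans (ℚP.+-monoʳ-≤ 1ℚ (ℚP.neg-antimono-≤ 0≤λ))
                       (ℚP.≤-reflexive (ℚP.+-identityʳ 1ℚ))

  levelCost-nonNeg : ∀ d h c → 0ℚ ≤ levelCost λ' d h c
  levelCost-nonNeg d zero    c = ℚP.≤-refl
  levelCost-nonNeg d (suc h) c = +-nonNeg (*-nonNeg (ℕ→ℚ-nonNeg (c 0)) (^ℚ-nonNeg (suc d) 0≤λ))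
                                          (levelCost-nonNeg (suc d) h (c ∘ suc))

  levelSum-nonNeg : ∀ n → 0ℚ ≤ levelSum b λ' n
  levelSum-nonNeg zero    = ℚP.≤-refl
  levelSum-nonNeg (suc n) = +-nonNeg (levelSum-nonNeg n)
                                     (*-nonNeg (ℕ→ℚ-nonNeg (b ℕ.^ suc n)) (^ℚ-nonNeg (suc n) 0≤λ))

  levelCost-snoc : ∀ d n c →
    levelCost λ' d (suc n) c ≡ levelCost λ' d n c + ℕ→ℚ (c n) * (λ' ^ℚ suc (d ℕ.+ n))
  levelCost-snoc d zero    c = begin-equality
    ℕ→ℚ (c 0) * (λ' ^ℚ suc d) + 0ℚ
      ≡⟨ ℚP.+-identityʳ _ ⟩
    ℕ→ℚ (c 0) * (λ' ^ℚ suc d)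
      ≡⟨ cong (λ e → ℕ→ℚ (c 0) * (λ' ^ℚ suc e)) (ℕP.+-identityʳ d) ⟨
    ℕ→ℚ (c 0) * (λ' ^ℚ suc (d ℕ.+ 0))
      ≡⟨ ℚP.+-identityˡ _ ⟨
    0ℚ + ℕ→ℚ (c 0) * (λ' ^ℚ suc (d ℕ.+ 0)) ∎
  levelCost-snoc d (suc n) c = begin-equality
    X + levelCost λ' (suc d) (suc n) (c ∘ suc)
      ≡⟨ cong (X +_) (levelCost-snoc (suc d) n (c ∘ suc)) ⟩
    X + (levelCost λ' (suc d) n (c ∘ suc) + ℕ→ℚ (c (suc n)) * (λ' ^ℚ suc (suc d ℕ.+ n)))
      ≡⟨ ℚP.+-assoc X _ _ ⟨
    levelCost λ' d (suc n) c + ℕ→ℚ (c (suc n)) * (λ' ^ℚ suc (suc d ℕ.+ n))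
      ≡⟨ cong (λ e → levelCost λ' d (suc n) c + ℕ→ℚ (c (suc n)) * (λ' ^ℚ suc e)) (ℕP.+-suc d n) ⟨
    levelCost λ' d (suc n) c + ℕ→ℚ (c (suc n)) * (λ' ^ℚ suc (d ℕ.+ suc n)) ∎
    where
    X = ℕ→ℚ (c 0) * (λ' ^ℚ suc d)

  levelCost-split : ∀ m d r c →
    levelCost λ' d (m ℕ.+ r) c ≡ levelCost λ' d m c + levelCost λ' (d ℕ.+ m) r (c ∘ (m ℕ.+_))
  levelCost-split zero    d r c = begin-equality
    levelCost λ' d r c                  ≡⟨ cong (λ e → levelCost λ' e r c) (ℕP.+-identityʳ d) ⟨
    levelCost λ' (d ℕ.+ 0) r c          ≡⟨ ℚP.+-identityˡ _ ⟨
    0ℚ + levelCost λ' (d ℕ.+ 0) r c     ∎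
  levelCost-split (suc m) d r c = begin-equality
    X + levelCost λ' (suc d) (m ℕ.+ r) (c ∘ suc)
      ≡⟨ cong (X +_) (levelCost-split m (suc d) r (c ∘ suc)) ⟩
    X + (levelCost λ' (suc d) m (c ∘ suc) + levelCost λ' (suc d ℕ.+ m) r (c ∘ (suc m ℕ.+_)))
      ≡⟨ ℚP.+-assoc X _ _ ⟨
    levelCost λ' d (suc m) c + levelCost λ' (suc d ℕ.+ m) r (c ∘ (suc m ℕ.+_))
      ≡⟨ cong (λ e → levelCost λ' d (suc m) c + levelCost λ' e r (c ∘ (suc m ℕ.+_)))
              (ℕP.+-suc d m) ⟨
    levelCost λ' d (suc m) c + levelCost λ' (d ℕ.+ suc m) r (c ∘ (suc m ℕ.+_)) ∎
    where
    X = ℕ→ℚ (c 0) * (λ' ^ℚ suc d)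

  levelCost≤levelSum : ∀ n c → (∀ j → c j ℕ.≤ b ℕ.^ suc j) → levelCost λ' 0 n c ≤ levelSum b λ' n
  levelCost≤levelSum zero    c c≤b^ = ℚP.≤-refl
  levelCost≤levelSum (suc n) c c≤b^ = begin
    levelCost λ' 0 (suc n) c
      ≡⟨ levelCost-snoc 0 n c ⟩
    levelCost λ' 0 n c + ℕ→ℚ (c n) * (λ' ^ℚ suc n)
      ≤⟨ ℚP.+-mono-≤ (levelCost≤levelSum n c c≤b^) last≤ ⟩
    levelSum b λ' (suc n) ∎
    where
    last≤ : ℕ→ℚ (c n) * (λ' ^ℚ suc n) ≤ ℕ→ℚ (b ℕ.^ suc n) * (λ' ^ℚ suc n)
    last≤ = *-monoʳ-≤ _ (^ℚ-nonNeg (suc n) 0≤λ) (ℕ→ℚ-mono-≤ (c≤b^ n))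

  -- The deeper levels telescope: k λ^(d+1) (1 - λ) + k λ^(d+2) = k λ^(d+1).
  levelCost-tail : ∀ {k} d r c → (∀ j → c j ℕ.≤ k) →
    levelCost λ' d r c * (1ℚ - λ') ≤ ℕ→ℚ k * (λ' ^ℚ suc d)
  levelCost-tail {k} d zero    c c≤k = begin
    0ℚ * (1ℚ - λ')         ≡⟨ ℚP.*-zeroˡ (1ℚ - λ') ⟩
    0ℚ                     ≤⟨ *-nonNeg (ℕ→ℚ-nonNeg k) (^ℚ-nonNeg (suc d) 0≤λ) ⟩
    ℕ→ℚ k * (λ' ^ℚ suc d)  ∎
  levelCost-tail {k} d (suc r) c c≤k = begin
    (ℕ→ℚ (c 0) * X + W) * (1ℚ - λ')            ≡⟨ ℚP.*-distribʳ-+ (1ℚ - λ') (ℕ→ℚ (c 0) * X) W ⟩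
    ℕ→ℚ (c 0) * X * (1ℚ - λ') + W * (1ℚ - λ')  ≤⟨ ℚP.+-mono-≤ first rest ⟩
    ℕ→ℚ k * X * (1ℚ - λ') + ℕ→ℚ k * (λ' * X)   ≡⟨ telescope (ℕ→ℚ k) X λ' ⟩
    ℕ→ℚ k * X                                   ∎
    where
    X = λ' ^ℚ suc d
    W = levelCost λ' (suc d) r (c ∘ suc)
    first : ℕ→ℚ (c 0) * X * (1ℚ - λ') ≤ ℕ→ℚ k * X * (1ℚ - λ')
    first = *-monoʳ-≤ (1ℚ - λ') 0≤1-λ (*-monoʳ-≤ X (^ℚ-nonNeg (suc d) 0≤λ) (ℕ→ℚ-mono-≤ (c≤k 0)))
    rest : W * (1ℚ - λ') ≤ ℕ→ℚ k * (λ' * X)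
    rest = levelCost-tail (suc d) r (c ∘ suc) (c≤k ∘ suc)
    telescope : ∀ k x l → k * x * (1ℚ - l) + k * (l * x) ≡ k * x
    telescope = solve 3 (λ k x l → k :* x :* (con 1ℚ :- l) :+ k :* (l :* x) := k :* x) refl

  -- With L = 0 this fails for k = 1: here the parity of k is needed.
  even*λ^≤levelSum : ∀ L {k} → k ℕ.≤ b ℕ.^ L → 2 ∣ k → ℕ→ℚ k * (λ' ^ℚ suc L) ≤ levelSum b λ' L
  even*λ^≤levelSum zero    {zero}        _        _ = ℚP.≤-reflexive (ℚP.*-zeroˡ (λ' ^ℚ 1))
  even*λ^≤levelSum zero    {suc zero}    _        2∣1 with ∣1⇒≡1 2∣1
  ... | ()
  even*λ^≤levelSum zero    {suc (suc k)} (s≤s ()) _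
  even*λ^≤levelSum (suc L) {k}           k≤b^L    _ = begin
    ℕ→ℚ k * (λ' * Y)       ≤⟨ *-monoˡ-≤ (ℕ→ℚ k) (ℕ→ℚ-nonNeg k) λY≤Y ⟩
    ℕ→ℚ k * Y              ≤⟨ *-monoʳ-≤ Y (^ℚ-nonNeg (suc L) 0≤λ) (ℕ→ℚ-mono-≤ k≤b^L) ⟩
    ℕ→ℚ (b ℕ.^ suc L) * Y  ≤⟨ p≤q+p _ (levelSum-nonNeg L) ⟩
    levelSum b λ' (suc L)  ∎
    where
    Y = λ' ^ℚ suc L
    λY≤Y : λ' * Y ≤ Y
    λY≤Y = ℚP.≤-trans (*-monoʳ-≤ Y (^ℚ-nonNeg (suc L) 0≤λ) λ≤1) (ℚP.≤-reflexive (ℚP.*-identityˡ Y))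

  levelCost-halves : ∀ {m n} c → m ℕ.≤ n → (∀ j → c j ℕ.≤ b ℕ.^ suc j) →
    levelCost λ' m (n ℕ.∸ m) (c ∘ (m ℕ.+_)) * (1ℚ - λ') ≤ levelSum b λ' m →
    levelCost λ' 0 n c * (1ℚ - λ') ≤ ℕ→ℚ 2 * levelSum b λ' m
  levelCost-halves {m} {n} c m≤n c≤b^ tail≤ = begin
    levelCost λ' 0 n c * (1ℚ - λ')
      ≡⟨ cong (λ e → levelCost λ' 0 e c * (1ℚ - λ')) (ℕP.m+[n∸m]≡n m≤n) ⟨
    levelCost λ' 0 (m ℕ.+ (n ℕ.∸ m)) c * (1ℚ - λ')
      ≡⟨ cong (_* (1ℚ - λ')) (levelCost-split m 0 (n ℕ.∸ m) c) ⟩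
    (head + tail) * (1ℚ - λ')
      ≡⟨ ℚP.*-distribʳ-+ (1ℚ - λ') head tail ⟩
    head * (1ℚ - λ') + tail * (1ℚ - λ')
      ≤⟨ ℚP.+-mono-≤ (ℚP.≤-trans (*[1-λ]-≤ (levelCost-nonNeg 0 m c)) (levelCost≤levelSum m c c≤b^))
                     tail≤ ⟩
    levelSum b λ' m + levelSum b λ' m
      ≡⟨ solve 1 (λ x → x :+ x := con (ℕ→ℚ 2) :* x) refl (levelSum b λ' m) ⟩
    ℕ→ℚ 2 * levelSum b λ' m ∎
    where
    head = levelCost λ' 0 m c
    tail = levelCost λ' m (n ℕ.∸ m) (c ∘ (m ℕ.+_))

  LevelBound⇒Top : ∀ {δ k q} → 2 ℕ.≤ b → 2 ∣ k → LevelBound b λ' b k 0 δ q →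
    q * (1ℚ - λ') ≤ ℕ→ℚ 2 * Top b δ λ' k
  LevelBound⇒Top {δ} {k} 2≤b 2∣k (levelBound c c≤b^ c≤k q≤) =
    ℚP.≤-trans (*-monoʳ-≤ (1ℚ - λ') 0≤1-λ q≤) (bound (δ ℕP.≤? L))
    where
    L = ceilLog b k
    Goal : ℕ → Set
    Goal m = levelCost λ' 0 δ c * (1ℚ - λ') ≤ ℕ→ℚ 2 * levelSum b λ' m
    emptyTail : levelCost λ' δ (δ ℕ.∸ δ) (c ∘ (δ ℕ.+_)) * (1ℚ - λ') ≤ levelSum b λ' δ
    emptyTail = subst (λ r → levelCost λ' δ r (c ∘ (δ ℕ.+_)) * (1ℚ - λ') ≤ levelSum b λ' δ)
      (sym (ℕP.n∸n≡0 δ)) (ℚP.≤-trans (ℚP.≤-reflexive (ℚP.*-zeroˡ (1ℚ - λ'))) (levelSum-nonNeg δ))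
    bound : Dec (δ ℕ.≤ L) → Goal (δ ℕ.⊓ L)
    bound (yes δ≤L) = subst Goal (sym (ℕP.m≤n⇒m⊓n≡m δ≤L))
      (levelCost-halves c (ℕP.≤-refl {δ}) c≤b^ emptyTail)
    bound (no δ≰L) = subst Goal (sym (ℕP.m≥n⇒m⊓n≡n L≤δ)) (levelCost-halves c L≤δ c≤b^ tail≤)
      where
      L≤δ : L ℕ.≤ δ
      L≤δ = ℕP.<⇒≤ (ℕP.≰⇒> δ≰L)
      tail≤ : levelCost λ' L (δ ℕ.∸ L) (c ∘ (L ℕ.+_)) * (1ℚ - λ') ≤ levelSum b λ' L
      tail≤ = ℚP.≤-trans (levelCost-tail L (δ ℕ.∸ L) (c ∘ (L ℕ.+_)) (c≤k ∘ (L ℕ.+_)))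
                         (even*λ^≤levelSum L (ceilLog-spec 2≤b k) 2∣k)

lemma14 : (b δ : ℕ) → 2 ℕ.≤ b → 1 ℕ.≤ δ →
    (λ' : ℚ) → 0ℚ < λ' → λ' < 1ℚ → 1ℚ ≤ ℕ→ℚ b * λ' →
    (pts : List (Vertex b δ)) → 2 ∣ length pts →
    Σ (List (Vertex b δ × Vertex b δ)) (λ ms →
      IsPerfectMatching ms pts ×
      matchingCost λ' ms * (1ℚ - λ') ≤ ℕ→ℚ 2 * Top b δ λ' (length pts))
lemma14 b δ 2≤b _ λ' 0<λ λ<1 _ pts 2∣k =
  let ms , perfect , bound = GreedyMatching.perfectMatching b δ λ' 0≤λ pts 2∣k
  in  ms , perfect , LevelCosts.LevelBound⇒Top 0≤λ (ℚP.<⇒≤ λ<1) 2≤b 2∣k bound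
  where
  0≤λ : 0ℚ ≤ λ'
  0≤λ = ℚP.<⇒≤ 0<λ
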